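{- For every positive integer $k$ and all non-negative integers $e$ and $i$, \[ f_{i+1}(k+1,e)-(1-t)f_{i+1}(k+2,e)+f_i(k,e)-f_i(k+1,e)=0 . \]
   Context: $t$ is an indeterminate. Binomial coefficients: for an integer $n$ and integer $j\ge0$, $\binom{n}{j}=n(n-1)\cdots(n-j+1)/j!$. For integers $k$, $i\ge0$, $e\ge0$, $f_i(k,e)=\sum_{j=0}^{e}\binom{e-j}{i}\binom{k+e-i-2}{j}t^j(1-t)^{e-i-j}\in\mathbb{Q}[t]$. -}

module Defs where

open import Data.Nat as ℕ using (ℕ; zero; suc; _!; _∸_)
open import Data.Nat.Properties using (_!≢0)
open import Data.Integer as ℤ using (ℤ; +_)
open import Data.Rational as ℚ using (ℚ; 0ℚ; 1ℚ)
open import Data.List using (List; []; _∷_; map)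
open import Data.List.Relation.Unary.All using (All)
open import Relation.Binary.PropositionalEquality using (_≡_)

falling : ℤ → ℕ → ℤ
falling n zero    = + 1
falling n (suc j) = falling n j ℤ.* (n ℤ.- + j)

binom : ℤ → ℕ → ℚ
binom n j = ℚ._/_ (falling n j) (j !) {{j !≢0}}

-- Univariate polynomials ℚ[t], as coefficient lists
-- (the head is the constant coefficient).  Trailing zeros are allowed;
-- a polynomial is zero iff all its coefficients are 0.

Poly : Set
Poly = List ℚ

const : ℚ → Poly
const c = c ∷ []

tP : Poly
tP = 0ℚ ∷ 1ℚ ∷ []

infixl 6 _+P_ _-P_
infixl 7 _*P_ _·P_

_+P_ : Poly → Poly → Poly
[]       +P q        = q
(a ∷ p)  +P []       = a ∷ p
(a ∷ p)  +P (b ∷ q)  = (a ℚ.+ b) ∷ (p +P q)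

_·P_ : ℚ → Poly → Poly
c ·P p = map (c ℚ.*_) p

negP : Poly → Poly
negP p = map ℚ.-_ p

_-P_ : Poly → Poly → Poly
p -P q = p +P negP q

_*P_ : Poly → Poly → Poly
[]      *P q = []
(a ∷ p) *P q = (a ·P q) +P (0ℚ ∷ (p *P q))

_^P_ : Poly → ℕ → Poly
p ^P zero  = const 1ℚ
p ^P suc n = p *P (p ^P n)

oneMinusT : Poly
oneMinusT = const 1ℚ -P tP

IsZeroP : Poly → Set
IsZeroP p = All (_≡ 0ℚ) p

sumTo : ℕ → (ℕ → Poly) → Poly
sumTo zero    g = g 0
sumTo (suc e) g = sumTo e g +P g (suc e)

-- f_i(k,e) = Σ_{j=0}^{e} C(e-j, i) C(k+e-i-2, j) t^j (1-t)^{e-i-j}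
-- The exponent e-i-j is taken with truncated subtraction; whenever
-- e-i-j < 0 (with 0 ≤ j ≤ e) the coefficient C(e-j,i) is 0, so the
-- term is 0 as in the paper.

f : ℕ → ℤ → ℕ → Poly
f i k e = sumTo e λ j →
  (binom (+ e ℤ.- + j) i ℚ.* binom (k ℤ.+ + e ℤ.- + i ℤ.- + 2) j)
    ·P ((tP ^P j) *P (oneMinusT ^P (e ∸ i ∸ j)))

{-# OPTIONS --safe #-}

-- Write each f_i(k,e) in the basis t^j (1-t)^(M-j) of degree M = e - i: the terms with
-- j > e - i vanish, since then 0 ≤ e - j < i.  For i < e the two f_{i+1} have degree M - 1
-- and are raised to degree M, multiplying by t + (1 - t) = 1 and by 1 - t respectively.
-- The coefficient of t^j (1-t)^(M-j) in the whole expression then cancels by Pascal's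
-- rule, applied to C(e-j+1, i+1) and to C(N+1, j) with N = k + e - i - 2.  For e ≤ i both
-- f_{i+1} vanish and the two f_i coincide.

module Submission where

open import Defs
open import Data.Nat using (ℕ; suc; _≥_)
open import Data.Integer using (+_; _+_)

open import Data.Nat as ℕ using (zero; _≤_; _<_; _∸_; _!; _<?_; z≤n; s≤s)
import Data.Nat.Properties as ℕP
open import Data.Integer as ℤ using (ℤ)
import Data.Integer.Properties as ℤP
open import Data.Integer.Tactic.RingSolver using (solve-∀)
open import Data.Rational as ℚ using (ℚ; 0ℚ; 1ℚ)
import Data.Rational.Properties as ℚP
open import Data.Rational.Solver using (module +-*-Solver)
open import Data.Rational.Unnormalised as ℚᵘ using (*≡*)
import Data.Rational.Unnormalised.Properties as ℚᵘP
open import Data.List using ([]; _∷_)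
open import Data.List.Relation.Unary.All using ([]; _∷_)
open import Data.Sum using (inj₁; inj₂)
open import Relation.Nullary using (yes; no; contradiction)
open import Relation.Binary.Bundles using (Setoid)
open import Relation.Binary.Structures using (IsEquivalence)
import Relation.Binary.Reasoning.Setoid as SetoidReasoning
open import Relation.Binary.PropositionalEquality

coeff : Poly → ℕ → ℚ
coeff []      n       = 0ℚ
coeff (a ∷ p) zero    = a
coeff (a ∷ p) (suc n) = coeff p n

infix 4 _≈P_

record _≈P_ (p q : Poly) : Set where
  constructor coeffwise
  field coeff-≡ : ∀ n → coeff p n ≡ coeff q n

open _≈P_

≈P-isEquivalence : IsEquivalence _≈P_
≈P-isEquivalence = record
  { refl  = coeffwise λ _ → refl
  ; sym   = λ p≈q → coeffwise λ n → sym (coeff-≡ p≈q n)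
  ; trans = λ p≈q q≈r → coeffwise λ n → trans (coeff-≡ p≈q n) (coeff-≡ q≈r n)
  }

≈P-setoid : Setoid _ _
≈P-setoid = record { Carrier = Poly ; _≈_ = _≈P_ ; isEquivalence = ≈P-isEquivalence }

open IsEquivalence ≈P-isEquivalence
  renaming (refl to ≈P-refl; sym to ≈P-sym; trans to ≈P-trans; reflexive to ≈P-reflexive)

module ≈P-Reasoning = SetoidReasoning ≈P-setoid

≈P[]⇒IsZeroP : ∀ {p} → p ≈P [] → IsZeroP p
≈P[]⇒IsZeroP {[]}    _    = []
≈P[]⇒IsZeroP {a ∷ p} p≈0 = coeff-≡ p≈0 0 ∷ ≈P[]⇒IsZeroP (coeffwise λ n → coeff-≡ p≈0 (suc n))

∷-cong : ∀ {a b p q} → a ≡ b → p ≈P q → a ∷ p ≈P b ∷ q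
∷-cong a≡b p≈q = coeffwise λ { zero → a≡b ; (suc n) → coeff-≡ p≈q n }

coeff-+P : ∀ p q n → coeff (p +P q) n ≡ coeff p n ℚ.+ coeff q n
coeff-+P []      q       n       = sym (ℚP.+-identityˡ _)
coeff-+P (a ∷ p) []      n       = sym (ℚP.+-identityʳ _)
coeff-+P (a ∷ p) (b ∷ q) zero    = refl
coeff-+P (a ∷ p) (b ∷ q) (suc n) = coeff-+P p q n

coeff-·P : ∀ c p n → coeff (c ·P p) n ≡ c ℚ.* coeff p n
coeff-·P c []      n       = sym (ℚP.*-zeroʳ c)
coeff-·P c (a ∷ p) zero    = refl
coeff-·P c (a ∷ p) (suc n) = coeff-·P c p n

coeff-negP : ∀ p n → coeff (negP p) n ≡ ℚ.- coeff p n
coeff-negP []      n       = refl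
coeff-negP (a ∷ p) zero    = refl
coeff-negP (a ∷ p) (suc n) = coeff-negP p n

+P-cong : ∀ {p p′ q q′} → p ≈P p′ → q ≈P q′ → p +P q ≈P p′ +P q′
+P-cong {p} {p′} {q} {q′} p≈p′ q≈q′ = coeffwise λ n →
  trans (coeff-+P p q n) (trans (cong₂ ℚ._+_ (coeff-≡ p≈p′ n) (coeff-≡ q≈q′ n)) (sym (coeff-+P p′ q′ n)))

negP-cong : ∀ {p p′} → p ≈P p′ → negP p ≈P negP p′
negP-cong {p} {p′} p≈p′ = coeffwise λ n →
  trans (coeff-negP p n) (trans (cong ℚ.-_ (coeff-≡ p≈p′ n)) (sym (coeff-negP p′ n)))

-P-cong : ∀ {p p′ q q′} → p ≈P p′ → q ≈P q′ → p -P q ≈P p′ -P q′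
-P-cong p≈p′ q≈q′ = +P-cong p≈p′ (negP-cong q≈q′)

·P-congˡ : ∀ c {p p′} → p ≈P p′ → c ·P p ≈P c ·P p′
·P-congˡ c {p} {p′} p≈p′ = coeffwise λ n →
  trans (coeff-·P c p n) (trans (cong (c ℚ.*_) (coeff-≡ p≈p′ n)) (sym (coeff-·P c p′ n)))

+P-identityʳ : ∀ p → p +P [] ≈P p
+P-identityʳ []      = ≈P-refl
+P-identityʳ (a ∷ p) = ≈P-refl

+P-comm : ∀ p q → p +P q ≈P q +P p
+P-comm p q = coeffwise λ n →
  trans (coeff-+P p q n) (trans (ℚP.+-comm (coeff p n) (coeff q n)) (sym (coeff-+P q p n)))

+P-assoc : ∀ p q r → (p +P q) +P r ≈P p +P (q +P r)
+P-assoc p q r = coeffwise λ n → begin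
  coeff ((p +P q) +P r) n                  ≡⟨ trans (coeff-+P (p +P q) r n) (cong (ℚ._+ coeff r n) (coeff-+P p q n)) ⟩
  (coeff p n ℚ.+ coeff q n) ℚ.+ coeff r n  ≡⟨ ℚP.+-assoc (coeff p n) (coeff q n) (coeff r n) ⟩
  coeff p n ℚ.+ (coeff q n ℚ.+ coeff r n)  ≡⟨ trans (coeff-+P p (q +P r) n) (cong (coeff p n ℚ.+_) (coeff-+P q r n)) ⟨
  coeff (p +P (q +P r)) n                  ∎
  where open ≡-Reasoning

+P-interchange : ∀ p q r s → (p +P q) +P (r +P s) ≈P (p +P r) +P (q +P s)
+P-interchange p q r s = begin
  (p +P q) +P (r +P s)  ≈⟨ +P-assoc p q (r +P s) ⟩
  p +P (q +P (r +P s))  ≈⟨ +P-cong (≈P-refl {p}) (+P-assoc q r s) ⟨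
  p +P ((q +P r) +P s)  ≈⟨ +P-cong (≈P-refl {p}) (+P-cong (+P-comm q r) (≈P-refl {s})) ⟩
  p +P ((r +P q) +P s)  ≈⟨ +P-cong (≈P-refl {p}) (+P-assoc r q s) ⟩
  p +P (r +P (q +P s))  ≈⟨ +P-assoc p r (q +P s) ⟨
  (p +P r) +P (q +P s)  ∎
  where open ≈P-Reasoning

·P-zeroˡ : ∀ {c} p → c ≡ 0ℚ → c ·P p ≈P []
·P-zeroˡ {c} p c≡0 = coeffwise λ n →
  trans (coeff-·P c p n) (trans (cong (ℚ._* coeff p n) c≡0) (ℚP.*-zeroˡ (coeff p n)))

·P-identityˡ : ∀ p → 1ℚ ·P p ≈P p
·P-identityˡ p = coeffwise λ n → trans (coeff-·P 1ℚ p n) (ℚP.*-identityˡ (coeff p n))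

·P-assoc : ∀ c d p → c ·P (d ·P p) ≈P (c ℚ.* d) ·P p
·P-assoc c d p = coeffwise λ n → begin
  coeff (c ·P (d ·P p)) n      ≡⟨ trans (coeff-·P c (d ·P p) n) (cong (c ℚ.*_) (coeff-·P d p n)) ⟩
  c ℚ.* (d ℚ.* coeff p n)      ≡⟨ ℚP.*-assoc c d (coeff p n) ⟨
  (c ℚ.* d) ℚ.* coeff p n      ≡⟨ coeff-·P (c ℚ.* d) p n ⟨
  coeff ((c ℚ.* d) ·P p) n     ∎
  where open ≡-Reasoning

·P-distribˡ-+P : ∀ c p q → c ·P (p +P q) ≈P c ·P p +P c ·P q
·P-distribˡ-+P c p q = coeffwise λ n → begin
  coeff (c ·P (p +P q)) n                ≡⟨ trans (coeff-·P c (p +P q) n) (cong (c ℚ.*_) (coeff-+P p q n)) ⟩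
  c ℚ.* (coeff p n ℚ.+ coeff q n)        ≡⟨ ℚP.*-distribˡ-+ c (coeff p n) (coeff q n) ⟩
  c ℚ.* coeff p n ℚ.+ c ℚ.* coeff q n    ≡⟨ cong₂ ℚ._+_ (coeff-·P c p n) (coeff-·P c q n) ⟨
  coeff (c ·P p) n ℚ.+ coeff (c ·P q) n  ≡⟨ coeff-+P (c ·P p) (c ·P q) n ⟨
  coeff (c ·P p +P c ·P q) n             ∎
  where open ≡-Reasoning

·P-distribʳ-+ : ∀ c d p → (c ℚ.+ d) ·P p ≈P c ·P p +P d ·P p
·P-distribʳ-+ c d p = coeffwise λ n → begin
  coeff ((c ℚ.+ d) ·P p) n               ≡⟨ coeff-·P (c ℚ.+ d) p n ⟩
  (c ℚ.+ d) ℚ.* coeff p n                ≡⟨ ℚP.*-distribʳ-+ (coeff p n) c d ⟩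
  c ℚ.* coeff p n ℚ.+ d ℚ.* coeff p n    ≡⟨ cong₂ ℚ._+_ (coeff-·P c p n) (coeff-·P d p n) ⟨
  coeff (c ·P p) n ℚ.+ coeff (d ·P p) n  ≡⟨ coeff-+P (c ·P p) (d ·P p) n ⟨
  coeff (c ·P p +P d ·P p) n             ∎
  where open ≡-Reasoning

negP-+P : ∀ p q → negP (p +P q) ≈P negP p +P negP q
negP-+P p q = coeffwise λ n → begin
  coeff (negP (p +P q)) n                    ≡⟨ trans (coeff-negP (p +P q) n) (cong ℚ.-_ (coeff-+P p q n)) ⟩
  ℚ.- (coeff p n ℚ.+ coeff q n)              ≡⟨ ℚP.neg-distrib-+ (coeff p n) (coeff q n) ⟩
  ℚ.- coeff p n ℚ.+ ℚ.- coeff q n            ≡⟨ cong₂ ℚ._+_ (coeff-negP p n) (coeff-negP q n) ⟨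
  coeff (negP p) n ℚ.+ coeff (negP q) n      ≡⟨ coeff-+P (negP p) (negP q) n ⟨
  coeff (negP p +P negP q) n                 ∎
  where open ≡-Reasoning

negP-·P : ∀ c p → negP (c ·P p) ≈P (ℚ.- c) ·P p
negP-·P c p = coeffwise λ n → begin
  coeff (negP (c ·P p)) n   ≡⟨ trans (coeff-negP (c ·P p) n) (cong ℚ.-_ (coeff-·P c p n)) ⟩
  ℚ.- (c ℚ.* coeff p n)     ≡⟨ ℚP.neg-distribˡ-* c (coeff p n) ⟩
  (ℚ.- c) ℚ.* coeff p n     ≡⟨ coeff-·P (ℚ.- c) p n ⟨
  coeff ((ℚ.- c) ·P p) n    ∎
  where open ≡-Reasoning

+P-inverseʳ : ∀ p → p -P p ≈P []
+P-inverseʳ p = coeffwise λ n →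
  trans (coeff-+P p (negP p) n) (trans (cong (coeff p n ℚ.+_) (coeff-negP p n)) (ℚP.+-inverseʳ (coeff p n)))

*P-zeroˡ : ∀ {p} q → p ≈P [] → p *P q ≈P []
*P-zeroˡ {[]}    q _   = ≈P-refl
*P-zeroˡ {a ∷ p} q p≈0 = begin
  a ·P q +P (0ℚ ∷ p *P q)  ≈⟨ +P-cong (·P-zeroˡ q (coeff-≡ p≈0 0)) (∷-cong refl (*P-zeroˡ {p} q (coeffwise λ n → coeff-≡ p≈0 (suc n)))) ⟩
  0ℚ ∷ []                  ≈⟨ coeffwise (λ { zero → refl ; (suc n) → refl }) ⟩
  []                       ∎
  where open ≈P-Reasoning

*P-zeroʳ : ∀ p → p *P [] ≈P []
*P-zeroʳ []      = ≈P-refl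
*P-zeroʳ (a ∷ p) = ≈P-trans (∷-cong refl (*P-zeroʳ p)) (coeffwise λ { zero → refl ; (suc n) → refl })

*P-congʳ : ∀ p {q q′} → q ≈P q′ → p *P q ≈P p *P q′
*P-congʳ []      q≈q′ = ≈P-refl
*P-congʳ (a ∷ p) q≈q′ = +P-cong (·P-congˡ a q≈q′) (∷-cong refl (*P-congʳ p q≈q′))

*P-congˡ : ∀ {p p′} q → p ≈P p′ → p *P q ≈P p′ *P q
*P-congˡ {[]}    {p′}     q p≈p′ = ≈P-sym (*P-zeroˡ q (≈P-sym p≈p′))
*P-congˡ {a ∷ p} {[]}     q p≈p′ = *P-zeroˡ q p≈p′
*P-congˡ {a ∷ p} {b ∷ p′} q p≈p′ =
  +P-cong (≈P-reflexive (cong (_·P q) (coeff-≡ p≈p′ 0)))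
          (∷-cong refl (*P-congˡ {p} {p′} q (coeffwise λ n → coeff-≡ p≈p′ (suc n))))

0∷-+P : ∀ p q → 0ℚ ∷ (p +P q) ≈P (0ℚ ∷ p) +P (0ℚ ∷ q)
0∷-+P p q = ∷-cong (sym (ℚP.+-identityˡ 0ℚ)) ≈P-refl

*P-distribˡ-+P : ∀ p q r → p *P (q +P r) ≈P p *P q +P p *P r
*P-distribˡ-+P []      q r = ≈P-refl
*P-distribˡ-+P (a ∷ p) q r = begin
  a ·P (q +P r) +P (0ℚ ∷ p *P (q +P r))
    ≈⟨ +P-cong (·P-distribˡ-+P a q r) (≈P-trans (∷-cong refl (*P-distribˡ-+P p q r)) (0∷-+P (p *P q) (p *P r))) ⟩
  (a ·P q +P a ·P r) +P ((0ℚ ∷ p *P q) +P (0ℚ ∷ p *P r))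
    ≈⟨ +P-interchange (a ·P q) (a ·P r) (0ℚ ∷ p *P q) (0ℚ ∷ p *P r) ⟩
  (a ·P q +P (0ℚ ∷ p *P q)) +P (a ·P r +P (0ℚ ∷ p *P r)) ∎
  where open ≈P-Reasoning

*P-distribʳ-+P : ∀ p q r → (p +P q) *P r ≈P p *P r +P q *P r
*P-distribʳ-+P []      q       r = ≈P-refl
*P-distribʳ-+P (a ∷ p) []      r = ≈P-sym (+P-identityʳ ((a ∷ p) *P r))
*P-distribʳ-+P (a ∷ p) (b ∷ q) r = begin
  (a ℚ.+ b) ·P r +P (0ℚ ∷ (p +P q) *P r)
    ≈⟨ +P-cong (·P-distribʳ-+ a b r) (≈P-trans (∷-cong refl (*P-distribʳ-+P p q r)) (0∷-+P (p *P r) (q *P r))) ⟩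
  (a ·P r +P b ·P r) +P ((0ℚ ∷ p *P r) +P (0ℚ ∷ q *P r))
    ≈⟨ +P-interchange (a ·P r) (b ·P r) (0ℚ ∷ p *P r) (0ℚ ∷ q *P r) ⟩
  (a ·P r +P (0ℚ ∷ p *P r)) +P (b ·P r +P (0ℚ ∷ q *P r)) ∎
  where open ≈P-Reasoning

·P-0∷ : ∀ c p → c ·P (0ℚ ∷ p) ≈P 0ℚ ∷ c ·P p
·P-0∷ c p = ∷-cong (ℚP.*-zeroʳ c) ≈P-refl

·P-*P-assoc : ∀ c p q → (c ·P p) *P q ≈P c ·P (p *P q)
·P-*P-assoc c []      q = ≈P-refl
·P-*P-assoc c (a ∷ p) q = begin
  (c ℚ.* a) ·P q +P (0ℚ ∷ (c ·P p) *P q)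
    ≈⟨ +P-cong (≈P-sym (·P-assoc c a q)) (≈P-trans (∷-cong refl (·P-*P-assoc c p q)) (≈P-sym (·P-0∷ c (p *P q)))) ⟩
  c ·P (a ·P q) +P c ·P (0ℚ ∷ p *P q)
    ≈⟨ ·P-distribˡ-+P c (a ·P q) (0ℚ ∷ p *P q) ⟨
  c ·P (a ·P q +P (0ℚ ∷ p *P q)) ∎
  where open ≈P-Reasoning

*P-·P-comm : ∀ c p q → p *P (c ·P q) ≈P c ·P (p *P q)
*P-·P-comm c []      q = ≈P-refl
*P-·P-comm c (a ∷ p) q = begin
  a ·P (c ·P q) +P (0ℚ ∷ p *P (c ·P q))
    ≈⟨ +P-cong a·c·q≈c·a·q (≈P-trans (∷-cong refl (*P-·P-comm c p q)) (≈P-sym (·P-0∷ c (p *P q)))) ⟩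
  c ·P (a ·P q) +P c ·P (0ℚ ∷ p *P q)
    ≈⟨ ·P-distribˡ-+P c (a ·P q) (0ℚ ∷ p *P q) ⟨
  c ·P (a ·P q +P (0ℚ ∷ p *P q)) ∎
  where
  open ≈P-Reasoning
  a·c·q≈c·a·q : a ·P (c ·P q) ≈P c ·P (a ·P q)
  a·c·q≈c·a·q = ≈P-trans (·P-assoc a c q)
    (≈P-trans (≈P-reflexive (cong (_·P q) (ℚP.*-comm a c))) (≈P-sym (·P-assoc c a q)))

0∷-*P : ∀ p q → (0ℚ ∷ p) *P q ≈P 0ℚ ∷ p *P q
0∷-*P p q = +P-cong (·P-zeroˡ q refl) (≈P-refl {0ℚ ∷ p *P q})

*P-∷ : ∀ p b q → p *P (b ∷ q) ≈P b ·P p +P (0ℚ ∷ p *P q)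
*P-∷ []      b q = coeffwise λ { zero → refl ; (suc n) → refl }
*P-∷ (a ∷ p) b q = ∷-cong (cong (ℚ._+ 0ℚ) (ℚP.*-comm a b)) (begin
  a ·P q +P p *P (b ∷ q)                   ≈⟨ +P-cong (≈P-refl {a ·P q}) (*P-∷ p b q) ⟩
  a ·P q +P (b ·P p +P (0ℚ ∷ p *P q))      ≈⟨ +P-assoc (a ·P q) (b ·P p) (0ℚ ∷ p *P q) ⟨
  (a ·P q +P b ·P p) +P (0ℚ ∷ p *P q)      ≈⟨ +P-cong (+P-comm (a ·P q) (b ·P p)) (≈P-refl {0ℚ ∷ p *P q}) ⟩
  (b ·P p +P a ·P q) +P (0ℚ ∷ p *P q)      ≈⟨ +P-assoc (b ·P p) (a ·P q) (0ℚ ∷ p *P q) ⟩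
  b ·P p +P (a ·P q +P (0ℚ ∷ p *P q))      ∎)
  where open ≈P-Reasoning

*P-comm : ∀ p q → p *P q ≈P q *P p
*P-comm []      q = ≈P-sym (*P-zeroʳ q)
*P-comm (a ∷ p) q = ≈P-trans (+P-cong (≈P-refl {a ·P q}) (∷-cong refl (*P-comm p q))) (≈P-sym (*P-∷ q a p))

*P-assoc : ∀ p q r → (p *P q) *P r ≈P p *P (q *P r)
*P-assoc []      q r = ≈P-refl
*P-assoc (a ∷ p) q r = begin
  (a ·P q +P (0ℚ ∷ p *P q)) *P r           ≈⟨ *P-distribʳ-+P (a ·P q) (0ℚ ∷ p *P q) r ⟩
  (a ·P q) *P r +P (0ℚ ∷ p *P q) *P r      ≈⟨ +P-cong (·P-*P-assoc a q r) (≈P-trans (0∷-*P (p *P q) r) (∷-cong refl (*P-assoc p q r))) ⟩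
  a ·P (q *P r) +P (0ℚ ∷ p *P (q *P r))    ∎
  where open ≈P-Reasoning

*P-identityˡ : ∀ p → const 1ℚ *P p ≈P p
*P-identityˡ p = ≈P-trans (+P-cong (·P-identityˡ p) (coeffwise λ { zero → refl ; (suc n) → refl })) (+P-identityʳ p)

sumTo-cong : ∀ n {g h} → (∀ j → j ≤ n → g j ≈P h j) → sumTo n g ≈P sumTo n h
sumTo-cong zero    g≈h = g≈h 0 z≤n
sumTo-cong (suc n) g≈h = +P-cong (sumTo-cong n λ j j≤n → g≈h j (ℕP.m≤n⇒m≤1+n j≤n)) (g≈h (suc n) ℕP.≤-refl)

sumTo-+P : ∀ n g h → sumTo n g +P sumTo n h ≈P sumTo n (λ j → g j +P h j)
sumTo-+P zero    g h = ≈P-refl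
sumTo-+P (suc n) g h = ≈P-trans (+P-interchange (sumTo n g) (g (suc n)) (sumTo n h) (h (suc n)))
                                (+P-cong (sumTo-+P n g h) (≈P-refl {g (suc n) +P h (suc n)}))

negP-sumTo : ∀ n g → negP (sumTo n g) ≈P sumTo n (λ j → negP (g j))
negP-sumTo zero    g = ≈P-refl
negP-sumTo (suc n) g = ≈P-trans (negP-+P (sumTo n g) (g (suc n))) (+P-cong (negP-sumTo n g) (≈P-refl {negP (g (suc n))}))

*P-sumTo : ∀ n p g → p *P sumTo n g ≈P sumTo n (λ j → p *P g j)
*P-sumTo zero    p g = ≈P-refl
*P-sumTo (suc n) p g = ≈P-trans (*P-distribˡ-+P p (sumTo n g) (g (suc n))) (+P-cong (*P-sumTo n p g) (≈P-refl {p *P g (suc n)}))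

sumTo-suc : ∀ n g → sumTo (suc n) g ≈P g 0 +P sumTo n (λ j → g (suc j))
sumTo-suc zero    g = ≈P-refl
sumTo-suc (suc n) g = ≈P-trans (+P-cong (sumTo-suc n g) (≈P-refl {g (suc (suc n))}))
                               (+P-assoc (g 0) (sumTo n (λ j → g (suc j))) (g (suc (suc n))))

sumTo-≈[] : ∀ n g → (∀ j → j ≤ n → g j ≈P []) → sumTo n g ≈P []
sumTo-≈[] zero    g g≈0 = g≈0 0 z≤n
sumTo-≈[] (suc n) g g≈0 = +P-cong (sumTo-≈[] n g λ j j≤n → g≈0 j (ℕP.m≤n⇒m≤1+n j≤n)) (g≈0 (suc n) ℕP.≤-refl)

sumTo-vanishing-tail : ∀ {m n} g → m ≤ n → (∀ j → m < j → j ≤ n → g j ≈P []) → sumTo n g ≈P sumTo m g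
sumTo-vanishing-tail {m} g m≤n tail≈0 with ℕP.m≤n⇒m<n∨m≡n m≤n
... | inj₂ refl = ≈P-refl
... | inj₁ (s≤s {n = n} m≤n′) = begin
  sumTo n g +P g (suc n)  ≈⟨ +P-cong (≈P-refl {sumTo n g}) (tail≈0 (suc n) (s≤s m≤n′) ℕP.≤-refl) ⟩
  sumTo n g +P []         ≈⟨ +P-identityʳ (sumTo n g) ⟩
  sumTo n g               ≈⟨ sumTo-vanishing-tail g m≤n′ (λ j m<j j≤n → tail≈0 j m<j (ℕP.m≤n⇒m≤1+n j≤n)) ⟩
  sumTo m g               ∎
  where open ≈P-Reasoning

-- Sums in the basis t^j (1-t)^(m-j)

basis : ℕ → ℕ → Poly
basis j r = (tP ^P j) *P (oneMinusT ^P r)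

bernstein : ℕ → (ℕ → ℚ) → Poly
bernstein m x = sumTo m λ j → x j ·P basis j (m ∸ j)

shift : (ℕ → ℚ) → ℕ → ℚ
shift x zero    = 0ℚ
shift x (suc j) = x j

tP+oneMinusT≈1 : tP +P oneMinusT ≈P const 1ℚ
tP+oneMinusT≈1 = coeffwise λ { zero → refl ; (suc zero) → refl ; (suc (suc n)) → refl }

bernstein-+P : ∀ m x y → bernstein m x +P bernstein m y ≈P bernstein m (λ j → x j ℚ.+ y j)
bernstein-+P m x y = ≈P-trans (sumTo-+P m _ _)
  (sumTo-cong m λ j _ → ≈P-sym (·P-distribʳ-+ (x j) (y j) (basis j (m ∸ j))))

bernstein--P : ∀ m x y → bernstein m x -P bernstein m y ≈P bernstein m (λ j → x j ℚ.- y j)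
bernstein--P m x y = ≈P-trans (+P-cong (≈P-refl {bernstein m x}) negP-bernstein) (bernstein-+P m x (λ j → ℚ.- y j))
  where
  negP-bernstein : negP (bernstein m y) ≈P bernstein m (λ j → ℚ.- y j)
  negP-bernstein = ≈P-trans (negP-sumTo m _) (sumTo-cong m λ j _ → negP-·P (y j) (basis j (m ∸ j)))

bernstein-≈[] : ∀ m x → (∀ j → j ≤ m → x j ≡ 0ℚ) → bernstein m x ≈P []
bernstein-≈[] m x x≡0 = sumTo-≈[] m _ λ j j≤m → ·P-zeroˡ (basis j (m ∸ j)) (x≡0 j j≤m)

tP*bernstein : ∀ m x → tP *P bernstein m x ≈P bernstein (suc m) (shift x)
tP*bernstein m x = begin
  tP *P bernstein m x
    ≈⟨ *P-sumTo m tP _ ⟩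
  sumTo m (λ j → tP *P (x j ·P basis j (m ∸ j)))
    ≈⟨ sumTo-cong m (λ j _ → ≈P-trans (*P-·P-comm (x j) tP (basis j (m ∸ j)))
                                      (·P-congˡ (x j) (≈P-sym (*P-assoc tP (tP ^P j) (oneMinusT ^P (m ∸ j)))))) ⟩
  sumTo m (λ j → x j ·P basis (suc j) (m ∸ j))
    ≈⟨ +P-cong (·P-zeroˡ (basis 0 (suc m)) refl) ≈P-refl ⟨
  0ℚ ·P basis 0 (suc m) +P sumTo m (λ j → x j ·P basis (suc j) (m ∸ j))
    ≈⟨ sumTo-suc m _ ⟨
  bernstein (suc m) (shift x) ∎
  where open ≈P-Reasoning

oneMinusT*basis : ∀ j r → oneMinusT *P basis j r ≈P basis j (suc r)
oneMinusT*basis j r = begin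
  oneMinusT *P ((tP ^P j) *P (oneMinusT ^P r))  ≈⟨ *P-assoc oneMinusT (tP ^P j) (oneMinusT ^P r) ⟨
  (oneMinusT *P (tP ^P j)) *P (oneMinusT ^P r)  ≈⟨ *P-congˡ (oneMinusT ^P r) (*P-comm oneMinusT (tP ^P j)) ⟩
  ((tP ^P j) *P oneMinusT) *P (oneMinusT ^P r)  ≈⟨ *P-assoc (tP ^P j) oneMinusT (oneMinusT ^P r) ⟩
  (tP ^P j) *P (oneMinusT ^P suc r)             ∎
  where open ≈P-Reasoning

oneMinusT*bernstein : ∀ m x → x (suc m) ≡ 0ℚ → oneMinusT *P bernstein m x ≈P bernstein (suc m) x
oneMinusT*bernstein m x x[1+m]≡0 = begin
  oneMinusT *P bernstein m x
    ≈⟨ *P-sumTo m oneMinusT _ ⟩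
  sumTo m (λ j → oneMinusT *P (x j ·P basis j (m ∸ j)))
    ≈⟨ sumTo-cong m (λ j j≤m → ≈P-trans (*P-·P-comm (x j) oneMinusT (basis j (m ∸ j)))
         (·P-congˡ (x j) (≈P-trans (oneMinusT*basis j (m ∸ j)) (≈P-reflexive (cong (basis j) (sym (ℕP.+-∸-assoc 1 j≤m))))))) ⟩
  sumTo m (λ j → x j ·P basis j (suc m ∸ j))
    ≈⟨ +P-identityʳ _ ⟨
  sumTo m (λ j → x j ·P basis j (suc m ∸ j)) +P []
    ≈⟨ +P-cong ≈P-refl (·P-zeroˡ (basis (suc m) (m ∸ m)) x[1+m]≡0) ⟨
  bernstein (suc m) x ∎
  where open ≈P-Reasoning

bernstein-elevate : ∀ m x → x (suc m) ≡ 0ℚ → bernstein m x ≈P bernstein (suc m) (λ j → shift x j ℚ.+ x j)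
bernstein-elevate m x x[1+m]≡0 = begin
  bernstein m x                                               ≈⟨ *P-identityˡ (bernstein m x) ⟨
  const 1ℚ *P bernstein m x                                   ≈⟨ *P-congˡ (bernstein m x) tP+oneMinusT≈1 ⟨
  (tP +P oneMinusT) *P bernstein m x                          ≈⟨ *P-distribʳ-+P tP oneMinusT (bernstein m x) ⟩
  tP *P bernstein m x +P oneMinusT *P bernstein m x           ≈⟨ +P-cong (tP*bernstein m x) (oneMinusT*bernstein m x x[1+m]≡0) ⟩
  bernstein (suc m) (shift x) +P bernstein (suc m) x          ≈⟨ bernstein-+P (suc m) (shift x) x ⟩
  bernstein (suc m) (λ j → shift x j ℚ.+ x j)                 ∎
  where open ≈P-Reasoning

falling-suc : ∀ x r → falling (x ℤ.+ + 1) (suc r) ≡ (x ℤ.+ + 1) ℤ.* falling x r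
falling-suc x zero = lemma x
  where
  lemma : ∀ x → + 1 ℤ.* ((x ℤ.+ + 1) ℤ.- + 0) ≡ (x ℤ.+ + 1) ℤ.* + 1
  lemma = solve-∀
falling-suc x (suc r) = begin
  falling (x ℤ.+ + 1) (suc r) ℤ.* ((x ℤ.+ + 1) ℤ.- + suc r) ≡⟨ cong (ℤ._* ((x ℤ.+ + 1) ℤ.- (+ 1 ℤ.+ + r))) (falling-suc x r) ⟩
  (x ℤ.+ + 1) ℤ.* falling x r ℤ.* ((x ℤ.+ + 1) ℤ.- (+ 1 ℤ.+ + r))  ≡⟨ lemma x (falling x r) (+ r) ⟩
  (x ℤ.+ + 1) ℤ.* (falling x r ℤ.* (x ℤ.- + r))                       ∎
  where
  open ≡-Reasoning
  lemma : ∀ x F r → (x ℤ.+ + 1) ℤ.* F ℤ.* ((x ℤ.+ + 1) ℤ.- (+ 1 ℤ.+ r)) ≡ (x ℤ.+ + 1) ℤ.* (F ℤ.* (x ℤ.- r))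
  lemma = solve-∀

falling-vanishes : ∀ {x r} → x < r → falling (+ x) r ≡ + 0
falling-vanishes {x} {suc r} x<1+r with ℕP.m≤n⇒m<n∨m≡n (ℕP.≤-pred x<1+r)
... | inj₁ x<r  = trans (cong (ℤ._* (+ x ℤ.- + r)) (falling-vanishes x<r)) (ℤP.*-zeroˡ (+ x ℤ.- + r))
... | inj₂ refl = trans (cong (falling (+ x) x ℤ.*_) (ℤP.+-inverseʳ (+ x))) (ℤP.*-zeroʳ (falling (+ x) x))

binom-vanishes : ∀ {x r} → x < r → binom (+ x) r ≡ 0ℚ
binom-vanishes {x} {r} x<r =
  trans (ℚP./-cong {{r ℕP.!≢0}} {{r ℕP.!≢0}} (falling-vanishes x<r) refl) (ℚP.0/n≡0 (r !) {{r ℕP.!≢0}})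

fromℚᵘ-/ : ∀ i n .{{_ : ℕ.NonZero n}} → ℚ.fromℚᵘ (i ℚᵘ./ n) ≡ i ℚ./ n
fromℚᵘ-/ i (suc n) = refl

toℚᵘ-binom : ∀ x r → ℚ.toℚᵘ (binom x r) ℚᵘ.≃ ℚᵘ._/_ (falling x r) (r !) {{r ℕP.!≢0}}
toℚᵘ-binom x r = ℚᵘP.≃-trans (ℚP.toℚᵘ-cong (sym (fromℚᵘ-/ (falling x r) (r !) {{r ℕP.!≢0}})))
                             (ℚP.toℚᵘ-fromℚᵘ _)

-- The second instance argument follows from the first, but instance search cannot find it.
pascalᵘ : ∀ x F r d .{{_ : ℕ.NonZero d}} .{{_ : ℕ.NonZero (suc r ℕ.* d)}} →
  ((x ℤ.+ + 1) ℤ.* F) ℚᵘ./ (suc r ℕ.* d) ℚᵘ.≃ (F ℤ.* (x ℤ.- + r)) ℚᵘ./ (suc r ℕ.* d) ℚᵘ.+ F ℚᵘ./ d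
pascalᵘ x F r (suc d) = *≡* (begin
  (x ℤ.+ + 1) ℤ.* F ℤ.* + (suc r ℕ.* suc d ℕ.* suc d)
    ≡⟨ cong ((x ℤ.+ + 1) ℤ.* F ℤ.*_) (trans (ℤP.pos-* (suc r ℕ.* suc d) (suc d)) (cong (ℤ._* + suc d) rd)) ⟩
  (x ℤ.+ + 1) ℤ.* F ℤ.* ((+ 1 ℤ.+ + r) ℤ.* + suc d ℤ.* + suc d)
    ≡⟨ lemma x F (+ r) (+ suc d) ⟩
  (F ℤ.* (x ℤ.- + r) ℤ.* + suc d ℤ.+ F ℤ.* ((+ 1 ℤ.+ + r) ℤ.* + suc d)) ℤ.* ((+ 1 ℤ.+ + r) ℤ.* + suc d)
    ≡⟨ sym (cong (λ u → (F ℤ.* (x ℤ.- + r) ℤ.* + suc d ℤ.+ F ℤ.* u) ℤ.* u) rd) ⟩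
  (F ℤ.* (x ℤ.- + r) ℤ.* + suc d ℤ.+ F ℤ.* + (suc r ℕ.* suc d)) ℤ.* + (suc r ℕ.* suc d) ∎)
  where
  open ≡-Reasoning
  rd : + (suc r ℕ.* suc d) ≡ (+ 1 ℤ.+ + r) ℤ.* + suc d
  rd = ℤP.pos-* (suc r) (suc d)
  lemma : ∀ x F r S → (x ℤ.+ + 1) ℤ.* F ℤ.* ((+ 1 ℤ.+ r) ℤ.* S ℤ.* S)
                    ≡ (F ℤ.* (x ℤ.- r) ℤ.* S ℤ.+ F ℤ.* ((+ 1 ℤ.+ r) ℤ.* S)) ℤ.* ((+ 1 ℤ.+ r) ℤ.* S)
  lemma = solve-∀

pascal : ∀ x r → binom (x ℤ.+ + 1) (suc r) ≡ binom x (suc r) ℚ.+ binom x r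
pascal x r = ℚP.toℚᵘ-injective (begin
  ℚ.toℚᵘ (binom (x ℤ.+ + 1) (suc r))
    ≈⟨ toℚᵘ-binom (x ℤ.+ + 1) (suc r) ⟩
  ℚᵘ._/_ (falling (x ℤ.+ + 1) (suc r)) (suc r !) {{suc r ℕP.!≢0}}
    ≡⟨ ℚᵘP./-cong {{suc r ℕP.!≢0}} {{suc r ℕP.!≢0}} (falling-suc x r) refl ⟩
  ℚᵘ._/_ ((x ℤ.+ + 1) ℤ.* falling x r) (suc r !) {{suc r ℕP.!≢0}}
    ≈⟨ pascalᵘ x (falling x r) r (r !) {{r ℕP.!≢0}} {{suc r ℕP.!≢0}} ⟩
  ℚᵘ._/_ (falling x (suc r)) (suc r !) {{suc r ℕP.!≢0}} ℚᵘ.+ ℚᵘ._/_ (falling x r) (r !) {{r ℕP.!≢0}}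
    ≈⟨ ℚᵘP.+-cong (toℚᵘ-binom x (suc r)) (toℚᵘ-binom x r) ⟨
  ℚ.toℚᵘ (binom x (suc r)) ℚᵘ.+ ℚ.toℚᵘ (binom x r)
    ≈⟨ ℚP.toℚᵘ-homo-+ (binom x (suc r)) (binom x r) ⟨
  ℚ.toℚᵘ (binom x (suc r) ℚ.+ binom x r) ∎)
  where open ℚᵘP.≃-Reasoning

fCoeff : ℕ → ℤ → ℕ → ℕ → ℚ
fCoeff i k e j = binom (+ e ℤ.- + j) i ℚ.* binom (k ℤ.+ + e ℤ.- + i ℤ.- + 2) j

fCoeff-vanishes : ∀ i k e {j} → j ≤ e → e ∸ j < i → fCoeff i k e j ≡ 0ℚ
fCoeff-vanishes i k e {j} j≤e e∸j<i = begin
  binom (+ e ℤ.- + j) i ℚ.* binom (k ℤ.+ + e ℤ.- + i ℤ.- + 2) j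
    ≡⟨ cong (λ x → binom x i ℚ.* binom (k ℤ.+ + e ℤ.- + i ℤ.- + 2) j) (trans (ℤP.m-n≡m⊖n e j) (ℤP.⊖-≥ j≤e)) ⟩
  binom (+ (e ∸ j)) i ℚ.* binom (k ℤ.+ + e ℤ.- + i ℤ.- + 2) j
    ≡⟨ cong (ℚ._* binom (k ℤ.+ + e ℤ.- + i ℤ.- + 2) j) (binom-vanishes e∸j<i) ⟩
  0ℚ ℚ.* binom (k ℤ.+ + e ℤ.- + i ℤ.- + 2) j
    ≡⟨ ℚP.*-zeroˡ (binom (k ℤ.+ + e ℤ.- + i ℤ.- + 2) j) ⟩
  0ℚ ∎
  where open ≡-Reasoning

m∸n<o⇒m∸o<n : ∀ {m n o} → o ≤ m → m ∸ n < o → m ∸ o < n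
m∸n<o⇒m∸o<n {m} {zero}  {o} o≤m m<o = contradiction o≤m (ℕP.<⇒≱ m<o)
m∸n<o⇒m∸o<n {m} {suc n} {o} o≤m m∸n<o = ℕP.m<n+o⇒m∸n<o m o (begin-strict
  m                    ≤⟨ ℕP.m≤n+m∸n m (suc n) ⟩
  suc n ℕ.+ (m ∸ suc n) <⟨ ℕP.+-monoʳ-< (suc n) m∸n<o ⟩
  suc n ℕ.+ o          ≡⟨ ℕP.+-comm (suc n) o ⟩
  o ℕ.+ suc n          ∎)
  where open ℕP.≤-Reasoning

fCoeff-vanishes-above : ∀ i k e {j} → j ≤ e → e ∸ i < j → fCoeff i k e j ≡ 0ℚ
fCoeff-vanishes-above i k e j≤e e∸i<j = fCoeff-vanishes i k e j≤e (m∸n<o⇒m∸o<n j≤e e∸i<j)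

f≈bernstein : ∀ i k e → f i k e ≈P bernstein (e ∸ i) (fCoeff i k e)
f≈bernstein i k e = sumTo-vanishing-tail _ (ℕP.m∸n≤m e i) λ j e∸i<j j≤e →
  ·P-zeroˡ (basis j (e ∸ i ∸ j)) (fCoeff-vanishes-above i k e j≤e e∸i<j)

pascal-cancellation : ∀ {a₀ a₁ b₁ c₁ d₁} P Q U V →
  a₀ ≡ (P ℚ.+ Q) ℚ.* U → a₁ ≡ P ℚ.* V → b₁ ≡ P ℚ.* (V ℚ.+ U) → c₁ ≡ Q ℚ.* V → d₁ ≡ Q ℚ.* (V ℚ.+ U) →
  a₀ ℚ.+ a₁ ℚ.- b₁ ℚ.+ c₁ ℚ.- d₁ ≡ 0ℚ
pascal-cancellation P Q U V refl refl refl refl refl =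
  solve 4 (λ P Q U V → (P :+ Q) :* U :+ P :* V :- P :* (V :+ U) :+ Q :* V :- Q :* (V :+ U) := con 0ℚ) refl P Q U V
  where open +-*-Solver

module Recurrence (k : ℤ) (e i : ℕ) where

  N : ℤ
  N = k ℤ.+ + e ℤ.- + i ℤ.- + 2

  a b c d : ℕ → ℚ
  a = fCoeff (suc i) (k ℤ.+ + 1) e
  b = fCoeff (suc i) (k ℤ.+ + 2) e
  c = fCoeff i k e
  d = fCoeff i (k ℤ.+ + 1) e

  coeff-recurrence : ∀ j → shift a j ℚ.+ a j ℚ.- b j ℚ.+ c j ℚ.- d j ≡ 0ℚ
  -- binom x 0 computes to 1, so b 0 ≡ a 0 and d 0 ≡ c 0 hold definitionally.
  coeff-recurrence zero    = solve 2 (λ x y → con 0ℚ :+ x :- x :+ y :- y := con 0ℚ) refl (a 0) (c 0)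
    where open +-*-Solver
  coeff-recurrence (suc j) = pascal-cancellation P Q U V
    (cong₂ ℚ._*_ (trans (cong (λ x → binom x (suc i)) e-j≡X+1) (pascal X i)) (cong (λ x → binom x j) upper-a))
    (cong (λ x → P ℚ.* binom x (suc j)) upper-a)
    (cong (P ℚ.*_) (trans (cong (λ x → binom x (suc j)) upper-b) (pascal N j)))
    refl
    (cong (Q ℚ.*_) (trans (cong (λ x → binom x (suc j)) upper-d) (pascal N j)))
    where
    X = + e ℤ.- + suc j
    P = binom X (suc i)
    Q = binom X i
    U = binom N j
    V = binom N (suc j)
    e-j≡X+1 : + e ℤ.- + j ≡ X ℤ.+ + 1
    e-j≡X+1 = lemma (+ e) (+ j)
      where
      lemma : ∀ e j → e ℤ.- j ≡ (e ℤ.- (+ 1 ℤ.+ j)) ℤ.+ + 1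
      lemma = solve-∀
    upper-a : (k ℤ.+ + 1) ℤ.+ + e ℤ.- + suc i ℤ.- + 2 ≡ N
    upper-a = lemma k (+ e) (+ i)
      where
      lemma : ∀ k e i → (k ℤ.+ + 1) ℤ.+ e ℤ.- (+ 1 ℤ.+ i) ℤ.- + 2 ≡ k ℤ.+ e ℤ.- i ℤ.- + 2
      lemma = solve-∀
    upper-b : (k ℤ.+ + 2) ℤ.+ + e ℤ.- + suc i ℤ.- + 2 ≡ N ℤ.+ + 1
    upper-b = lemma k (+ e) (+ i)
      where
      lemma : ∀ k e i → (k ℤ.+ + 2) ℤ.+ e ℤ.- (+ 1 ℤ.+ i) ℤ.- + 2 ≡ (k ℤ.+ e ℤ.- i ℤ.- + 2) ℤ.+ + 1
      lemma = solve-∀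
    upper-d : (k ℤ.+ + 1) ℤ.+ + e ℤ.- + i ℤ.- + 2 ≡ N ℤ.+ + 1
    upper-d = lemma k (+ e) (+ i)
      where
      lemma : ∀ k e i → (k ℤ.+ + 1) ℤ.+ e ℤ.- i ℤ.- + 2 ≡ (k ℤ.+ e ℤ.- i ℤ.- + 2) ℤ.+ + 1
      lemma = solve-∀

  A B C D : Poly
  A = f (suc i) (k ℤ.+ + 1) e
  B = f (suc i) (k ℤ.+ + 2) e
  C = f i k e
  D = f i (k ℤ.+ + 1) e

  recurrence-i<e : i < e → A -P oneMinusT *P B +P C -P D ≈P []
  recurrence-i<e i<e = begin
    A -P oneMinusT *P B +P C -P D
      ≈⟨ -P-cong (+P-cong (-P-cong A≈ [1-t]B≈) C≈) D≈ ⟩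
    bernstein M a′ -P bernstein M b +P bernstein M c -P bernstein M d
      ≈⟨ -P-cong (+P-cong (bernstein--P M a′ b) (≈P-refl {bernstein M c})) (≈P-refl {bernstein M d}) ⟩
    bernstein M (λ j → a′ j ℚ.- b j) +P bernstein M c -P bernstein M d
      ≈⟨ -P-cong (bernstein-+P M (λ j → a′ j ℚ.- b j) c) (≈P-refl {bernstein M d}) ⟩
    bernstein M (λ j → a′ j ℚ.- b j ℚ.+ c j) -P bernstein M d
      ≈⟨ bernstein--P M (λ j → a′ j ℚ.- b j ℚ.+ c j) d ⟩
    bernstein M (λ j → a′ j ℚ.- b j ℚ.+ c j ℚ.- d j)
      ≈⟨ bernstein-≈[] M _ (λ j _ → coeff-recurrence j) ⟩
    [] ∎
    where
    open ≈P-Reasoning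
    m M : ℕ
    m = e ∸ suc i
    M = suc m
    a′ : ℕ → ℚ
    a′ j = shift a j ℚ.+ a j
    e∸i≡M : e ∸ i ≡ M
    e∸i≡M = ℕP.+-∸-assoc 1 i<e
    M≤e : M ≤ e
    M≤e = subst (_≤ e) e∸i≡M (ℕP.m∸n≤m e i)
    A≈ : A ≈P bernstein M a′
    A≈ = ≈P-trans (f≈bernstein (suc i) (k ℤ.+ + 1) e)
                  (bernstein-elevate m a (fCoeff-vanishes-above (suc i) (k ℤ.+ + 1) e M≤e (ℕP.n<1+n m)))
    [1-t]B≈ : oneMinusT *P B ≈P bernstein M b
    [1-t]B≈ = ≈P-trans (*P-congʳ oneMinusT (f≈bernstein (suc i) (k ℤ.+ + 2) e))
                       (oneMinusT*bernstein m b (fCoeff-vanishes-above (suc i) (k ℤ.+ + 2) e M≤e (ℕP.n<1+n m)))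
    C≈ : C ≈P bernstein M c
    C≈ = subst (λ n → C ≈P bernstein n c) e∸i≡M (f≈bernstein i k e)
    D≈ : D ≈P bernstein M d
    D≈ = subst (λ n → D ≈P bernstein n d) e∸i≡M (f≈bernstein i (k ℤ.+ + 1) e)

  recurrence-e≤i : e ≤ i → A -P oneMinusT *P B +P C -P D ≈P []
  recurrence-e≤i e≤i = begin
    A -P oneMinusT *P B +P C -P D   ≈⟨ -P-cong (+P-cong (-P-cong A≈[] [1-t]B≈[]) C≈D) (≈P-refl {D}) ⟩
    D -P D                          ≈⟨ +P-inverseʳ D ⟩
    []                              ∎
    where
    open ≈P-Reasoning
    f-suc≈[] : ∀ k′ → f (suc i) k′ e ≈P []
    f-suc≈[] k′ = ≈P-trans (f≈bernstein (suc i) k′ e) (bernstein-≈[] (e ∸ suc i) _ λ j j≤e∸1+i →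
      fCoeff-vanishes (suc i) k′ e (ℕP.≤-trans j≤e∸1+i (ℕP.m∸n≤m e (suc i))) (s≤s (ℕP.≤-trans (ℕP.m∸n≤m e j) e≤i)))
    A≈[] : A ≈P []
    A≈[] = f-suc≈[] (k ℤ.+ + 1)
    [1-t]B≈[] : oneMinusT *P B ≈P []
    [1-t]B≈[] = ≈P-trans (*P-congʳ oneMinusT (f-suc≈[] (k ℤ.+ + 2))) (*P-zeroʳ oneMinusT)
    e∸i≡0 : e ∸ i ≡ 0
    e∸i≡0 = ℕP.m≤n⇒m∸n≡0 e≤i
    C≈D : C ≈P D
    C≈D = begin
      C                   ≈⟨ f≈bernstein i k e ⟩
      bernstein (e ∸ i) c ≡⟨ cong (λ n → bernstein n c) e∸i≡0 ⟩
      bernstein 0 d       ≡⟨ cong (λ n → bernstein n d) e∸i≡0 ⟨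
      bernstein (e ∸ i) d ≈⟨ f≈bernstein i (k ℤ.+ + 1) e ⟨
      D                   ∎

  recurrence : A -P oneMinusT *P B +P C -P D ≈P []
  recurrence with i <? e
  ... | yes i<e = recurrence-i<e i<e
  ... | no  i≮e = recurrence-e≤i (ℕP.≮⇒≥ i≮e)

lemma2p3 : (k e i : ℕ) → k ≥ 1 →
    IsZeroP (f (suc i) (+ k + + 1) e -P (oneMinusT *P f (suc i) (+ k + + 2) e)
              +P f i (+ k) e -P f i (+ k + + 1) e)
lemma2p3 k e i _ = ≈P[]⇒IsZeroP (Recurrence.recurrence (+ k) e i)
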